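{- There is no faithful functor from $\mathbf{Graphs}_\omega$ to the category of ordered fields (with order-preserving field homomorphisms), or even to the category of ordered (totally ordered) sets with order-preserving maps.
   Context: $\mathbf{Graphs}_\omega$ is the category whose objects are graphs $(\omega,E)$ with $E$ a set of $2$-element subsets of $\omega$, and whose morphisms $(\omega,E)\to(\omega,E')$ are injections $f\colon\omega\to\omega$ with $\{i,j\}\in E\iff\{f(i),f(j)\}\in E'$. -}

module Defs where

open import Level using (Level; _⊔_) renaming (suc to lsuc)
open import Data.Nat using (ℕ)
open import Data.Bool using (Bool; false)
open import Data.Product using (∃)
open import Relation.Nullary using (¬_)
open import Relation.Binary.PropositionalEquality using (_≡_; refl)
open import Relation.Binary.Bundles using (TotalOrder)
open import Relation.Binary.Structures using (IsTotalOrder)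
open import Algebra.Structures using (IsCommutativeRing)

-- A graph (ω, E): E is a set of 2-element subsets of ω, encoded as a
-- symmetric, irreflexive Bool-valued relation on ℕ.
record Graph : Set where
  field
    edge   : ℕ → ℕ → Bool
    sym    : ∀ i j → edge i j ≡ edge j i
    irrefl : ∀ i → edge i i ≡ false

record GraphHom (G H : Graph) : Set where
  field
    fun       : ℕ → ℕ
    injective : ∀ {i j} → fun i ≡ fun j → i ≡ j
    preserves : ∀ i j → Graph.edge H (fun i) (fun j) ≡ Graph.edge G i j

open GraphHom

_≈G_ : ∀ {G H} → GraphHom G H → GraphHom G H → Set
f ≈G g = ∀ i → fun f i ≡ fun g i

idG : ∀ {G} → GraphHom G G
idG = record { fun = λ i → i ; injective = λ e → e ; preserves = λ i j → refl }

_∘G_ : ∀ {G H K} → GraphHom H K → GraphHom G H → GraphHom G K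
_∘G_ {G} {H} {K} g f = record
  { fun       = λ i → fun g (fun f i)
  ; injective = λ e → injective f (injective g e)
  ; preserves = λ i j → Relation.Binary.PropositionalEquality.trans
                          (preserves g (fun f i) (fun f j)) (preserves f i j)
  }

record Functor {o h e : Level}
               (Obj : Set o)
               (Hom : Obj → Obj → Set h)
               (_≈_ : ∀ {A B} → Hom A B → Hom A B → Set e)
               (id  : ∀ {A} → Hom A A)
               (_∘_ : ∀ {A B C} → Hom B C → Hom A B → Hom A C)
               : Set (o ⊔ h ⊔ e) where
  field
    F₀     : Graph → Obj
    F₁     : ∀ {G H} → GraphHom G H → Hom (F₀ G) (F₀ H)
    F-resp : ∀ {G H} {f g : GraphHom G H} → f ≈G g → F₁ f ≈ F₁ g
    F-id   : ∀ {G} → F₁ (idG {G}) ≈ id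
    F-∘    : ∀ {G H K} (f : GraphHom G H) (g : GraphHom H K) →
             F₁ (g ∘G f) ≈ (F₁ g ∘ F₁ f)

  Faithful : Set e
  Faithful = ∀ {G H} {f g : GraphHom G H} → F₁ f ≈ F₁ g → f ≈G g

module _ {c ℓ₁ ℓ₂ : Level} where

  record Monotone (A B : TotalOrder c ℓ₁ ℓ₂) : Set (c ⊔ ℓ₁ ⊔ ℓ₂) where
    field
      fun  : TotalOrder.Carrier A → TotalOrder.Carrier B
      cong : ∀ {x y} → TotalOrder._≈_ A x y → TotalOrder._≈_ B (fun x) (fun y)
      mono : ∀ {x y} → TotalOrder._≤_ A x y → TotalOrder._≤_ B (fun x) (fun y)

  _≈M_ : ∀ {A B} → Monotone A B → Monotone A B → Set (c ⊔ ℓ₁)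
  _≈M_ {A} {B} f g = ∀ x → TotalOrder._≈_ B (Monotone.fun f x) (Monotone.fun g x)

  idM : ∀ {A} → Monotone A A
  idM = record { fun = λ x → x ; cong = λ p → p ; mono = λ p → p }

  _∘M_ : ∀ {A B C} → Monotone B C → Monotone A B → Monotone A C
  g ∘M f = record
    { fun  = λ x → Monotone.fun g (Monotone.fun f x)
    ; cong = λ p → Monotone.cong g (Monotone.cong f p)
    ; mono = λ p → Monotone.mono g (Monotone.mono f p)
    }

FunctorToTotalOrders : (c ℓ₁ ℓ₂ : Level) → Set (lsuc (c ⊔ ℓ₁ ⊔ ℓ₂))
FunctorToTotalOrders c ℓ₁ ℓ₂ =
  Functor (TotalOrder c ℓ₁ ℓ₂) Monotone _≈M_ idM _∘M_

record OrderedField (c ℓ₁ ℓ₂ : Level) : Set (lsuc (c ⊔ ℓ₁ ⊔ ℓ₂)) where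
  infix  4 _≈_ _≤_
  infixl 6 _+_
  infixl 7 _*_
  field
    Carrier : Set c
    _≈_     : Carrier → Carrier → Set ℓ₁
    _≤_     : Carrier → Carrier → Set ℓ₂
    _+_     : Carrier → Carrier → Carrier
    _*_     : Carrier → Carrier → Carrier
    -_      : Carrier → Carrier
    0#      : Carrier
    1#      : Carrier
    isCommutativeRing : IsCommutativeRing _≈_ _+_ _*_ -_ 0# 1#
    0≉1     : ¬ (0# ≈ 1#)
    inverse : ∀ x → ¬ (x ≈ 0#) → ∃ λ y → x * y ≈ 1#
    isTotalOrder : IsTotalOrder _≈_ _≤_
    +-mono-≤ : ∀ {x y} z → x ≤ y → x + z ≤ y + z
    *-nonneg : ∀ {x y} → 0# ≤ x → 0# ≤ y → 0# ≤ x * y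

module _ {c ℓ₁ ℓ₂ : Level} where

  record OrderedFieldHom (A B : OrderedField c ℓ₁ ℓ₂) : Set (c ⊔ ℓ₁ ⊔ ℓ₂) where
    private
      module A = OrderedField A
      module B = OrderedField B
    field
      fun    : A.Carrier → B.Carrier
      cong   : ∀ {x y} → x A.≈ y → fun x B.≈ fun y
      hom-+  : ∀ x y → fun (x A.+ y) B.≈ fun x B.+ fun y
      hom-*  : ∀ x y → fun (x A.* y) B.≈ fun x B.* fun y
      hom-1  : fun A.1# B.≈ B.1#
      mono   : ∀ {x y} → x A.≤ y → fun x B.≤ fun y

  _≈F_ : ∀ {A B} → OrderedFieldHom A B → OrderedFieldHom A B → Set (c ⊔ ℓ₁)
  _≈F_ {A} {B} f g =
    ∀ x → OrderedField._≈_ B (OrderedFieldHom.fun f x) (OrderedFieldHom.fun g x)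

  idF : ∀ {A} → OrderedFieldHom A A
  idF {A} = record
    { fun = λ x → x ; cong = λ p → p
    ; hom-+ = λ x y → refl≈ ; hom-* = λ x y → refl≈ ; hom-1 = refl≈
    ; mono = λ p → p }
    where refl≈ = λ {x} → IsCommutativeRing.refl (OrderedField.isCommutativeRing A) {x}

  _∘F_ : ∀ {A B C} → OrderedFieldHom B C → OrderedFieldHom A B → OrderedFieldHom A C
  _∘F_ {A} {B} {C} g f = record
    { fun   = λ x → G.fun (F.fun x)
    ; cong  = λ p → G.cong (F.cong p)
    ; hom-+ = λ x y → trans (G.cong (F.hom-+ x y)) (G.hom-+ _ _)
    ; hom-* = λ x y → trans (G.cong (F.hom-* x y)) (G.hom-* _ _)
    ; hom-1 = trans (G.cong F.hom-1) G.hom-1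
    ; mono  = λ p → G.mono (F.mono p)
    }
    where
      module F = OrderedFieldHom f
      module G = OrderedFieldHom g
      trans = IsCommutativeRing.trans (OrderedField.isCommutativeRing C)

FunctorToOrderedFields : (c ℓ₁ ℓ₂ : Level) → Set (lsuc (c ⊔ ℓ₁ ⊔ ℓ₂))
FunctorToOrderedFields c ℓ₁ ℓ₂ =
  Functor (OrderedField c ℓ₁ ℓ₂) OrderedFieldHom _≈F_ idF _∘F_

module Submission where

-- In a totally ordered set a monotone involution must be the
-- identity: if f x ≤ x then x ≈ f (f x) ≤ f x, and symmetrically.  The
-- edgeless graph on ω has the nontrivial automorphism σ swapping 0 and 1,
-- with σ ∘ σ = id.  Any functor F into totally ordered sets turns σ into a
-- monotone involution F σ, hence F σ ≈ id ≈ F id while σ ≠ id, so F is not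
-- faithful.  For ordered fields we forget the algebraic structure: the
-- forgetful functor from ordered fields to total orders is the identity on
-- maps, so post-composing with it preserves faithfulness and reduces the
-- first claim to the second.

open import Defs
open import Level using (Level)
open import Data.Product using (Σ; _×_; _,_)
open import Relation.Nullary using (¬_)
open import Data.Nat using (ℕ; zero; suc)
open import Data.Bool using (false)
open import Data.Sum using (inj₁; inj₂)
open import Relation.Binary.PropositionalEquality using (_≡_; refl; sym; cong; module ≡-Reasoning)
open import Relation.Binary.Structures using (IsTotalOrder)
open import Relation.Binary.Bundles using (TotalOrder)

module _ {a ℓ₁ ℓ₂} {A : Set a} {_≈_ : A → A → Set ℓ₁} {_≤_ : A → A → Set ℓ₂}
         (T : IsTotalOrder _≈_ _≤_) where
  open IsTotalOrder T

  monotone-involution-is-id :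
    (f : A → A) → (∀ {x y} → x ≤ y → f x ≤ f y) →
    (∀ x → f (f x) ≈ x) → ∀ x → f x ≈ x
  monotone-involution-is-id f mono involutive x with total (f x) x
  ... | inj₁ fx≤x = antisym fx≤x (trans (reflexive (Eq.sym (involutive x))) (mono fx≤x))
  ... | inj₂ x≤fx = antisym (trans (mono x≤fx) (reflexive (involutive x))) x≤fx

-- The edgeless graph on ω; every bijection of ω is an automorphism of it.
edgeless : Graph
edgeless = record { edge = λ _ _ → false ; sym = λ _ _ → refl ; irrefl = λ _ → refl }

swap01 : ℕ → ℕ
swap01 zero          = suc zero
swap01 (suc zero)    = zero
swap01 (suc (suc n)) = suc (suc n)

swap01-involutive : ∀ n → swap01 (swap01 n) ≡ n
swap01-involutive zero          = refl
swap01-involutive (suc zero)    = refl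
swap01-involutive (suc (suc n)) = refl

swap01-injective : ∀ {i j} → swap01 i ≡ swap01 j → i ≡ j
swap01-injective {i} {j} eq = begin
  i                    ≡⟨ sym (swap01-involutive i) ⟩
  swap01 (swap01 i)    ≡⟨ cong swap01 eq ⟩
  swap01 (swap01 j)    ≡⟨ swap01-involutive j ⟩
  j                    ∎
  where open ≡-Reasoning

swap : GraphHom edgeless edgeless
swap = record { fun = swap01 ; injective = swap01-injective ; preserves = λ _ _ → refl }

swap-involutive : (swap ∘G swap) ≈G idG
swap-involutive = swap01-involutive

swap-nontrivial : ¬ (swap ≈G idG)
swap-nontrivial swap≈id with swap≈id zero
... | ()

no-faithful-functor-to-total-orders :
  ∀ c ℓ₁ ℓ₂ → ¬ Σ (FunctorToTotalOrders c ℓ₁ ℓ₂) Functor.Faithful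
no-faithful-functor-to-total-orders c ℓ₁ ℓ₂ (F , faithful) =
  swap-nontrivial (faithful F-swap≈F-id)
  where
    open Functor F
    open TotalOrder (F₀ edgeless) using (isTotalOrder; module Eq)

    F-swap-involutive : ∀ x → Monotone.fun (F₁ swap) (Monotone.fun (F₁ swap) x)
                                Eq.≈ x
    F-swap-involutive x =
      Eq.trans (Eq.sym (F-∘ swap swap x)) (Eq.trans (F-resp swap-involutive x) (F-id x))

    F-swap≈F-id : F₁ swap ≈M F₁ idG
    F-swap≈F-id x =
      Eq.trans (monotone-involution-is-id isTotalOrder (Monotone.fun (F₁ swap))
                  (Monotone.mono (F₁ swap)) F-swap-involutive x)
               (Eq.sym (F-id x))

underlying-order : ∀ {c ℓ₁ ℓ₂} → OrderedField c ℓ₁ ℓ₂ → TotalOrder c ℓ₁ ℓ₂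
underlying-order K = record { isTotalOrder = OrderedField.isTotalOrder K }

underlying-monotone : ∀ {c ℓ₁ ℓ₂} {K L : OrderedField c ℓ₁ ℓ₂} →
  OrderedFieldHom K L → Monotone (underlying-order K) (underlying-order L)
underlying-monotone f = record
  { fun = OrderedFieldHom.fun f ; cong = OrderedFieldHom.cong f ; mono = OrderedFieldHom.mono f }

-- Composing with the forgetful functor gives a functor to total orders;
-- since both categories compare maps pointwise, the functor laws and
-- faithfulness carry over unchanged.
forget-order : ∀ {c ℓ₁ ℓ₂} → FunctorToOrderedFields c ℓ₁ ℓ₂ → FunctorToTotalOrders c ℓ₁ ℓ₂
forget-order F = record
  { F₀     = λ G → underlying-order (F₀ G)
  ; F₁     = λ f → underlying-monotone (F₁ f)
  ; F-resp = F-resp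
  ; F-id   = F-id
  ; F-∘    = F-∘
  }
  where open Functor F

no-faithful-functor-to-ordered-fields :
  ∀ c ℓ₁ ℓ₂ → ¬ Σ (FunctorToOrderedFields c ℓ₁ ℓ₂) Functor.Faithful
no-faithful-functor-to-ordered-fields c ℓ₁ ℓ₂ (F , faithful) =
  no-faithful-functor-to-total-orders c ℓ₁ ℓ₂ (forget-order F , faithful)

proposition8p2 : (c ℓ₁ ℓ₂ : Level) →
    (¬ Σ (FunctorToOrderedFields c ℓ₁ ℓ₂) Functor.Faithful)
    × (¬ Σ (FunctorToTotalOrders c ℓ₁ ℓ₂) Functor.Faithful)
proposition8p2 c ℓ₁ ℓ₂ =
  no-faithful-functor-to-ordered-fields c ℓ₁ ℓ₂ , no-faithful-functor-to-total-orders c ℓ₁ ℓ₂
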